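{- Fix a prime power $q$ and an integer $g\geq 1$, and let $a_1,\dots,a_g$ be indeterminates. For $0\le n\le g$ let $A_n\in\mathbb{Q}[a_1,\dots,a_g]$ be the coefficient of $t^n$ in the formal power series $$(1-t)(1-qt)\prod_{d=1}^{g}(1-t^d)^{ -a_d},\qquad (1-t^d)^{ -a}:=\sum_{j\ge 0}\binom{ -a}{j}(-t^d)^j,$$ where $\binom{ -a}{j}=\frac{(-a)(-a-1)\cdots(-a-j+1)}{j!}$. Define $H_0,\dots,H_g\in\mathbb{Q}[a_1,\dots,a_g]$ as the unique solution of the lower triangular system $$A_n=\sum_{\substack{0\le k\le n\\ k\equiv n \ (\mathrm{mod}\ 2)}} H_k\binom{g-k}{(n-k)/2}q^{(n-k)/2},\qquad 0\le n\le g .$$ Then for every $1\le i\le g$, the polynomial $H_i$ does not involve the variables $a_{i+1},\dots,a_g$ (i.e. $H_i\in\mathbb{Q}[a_1,\dots,a_i]$) and has degree $1$ in the variable $a_i$.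
   Context: Motivation/meaning: for a curve $C$ of genus $g$ over $\mathbb{F}_q$ with $a_d$ closed points of degree $d$, the zeta function is $P(t)/((1-t)(1-qt))=\prod_{d\ge1}(1-t^d)^{ -a_d}$ with $P(t)=\sum_{n=0}^{2g}A_nt^n$, and the real Weil polynomial $h(x)=\sum_{n=0}^g H_n x^{g-n}$ satisfies $P(t)=t^g h((qt^2+1)/t)$; the polynomials above give the coefficients $A_n$ ($n\le g$) and $H_n$ as functions of $a_1,\dots,a_g$. -}

module Defs where

open import Data.Nat as ℕ using (ℕ; zero; suc; _≤_; _<_; _∸_; _^_; _%_; _!)
open import Data.Nat.Properties using (_!≢0)
open import Data.Nat.Combinatorics using (_C_)
open import Data.Nat.Primality using (Prime)
open import Data.Integer as ℤ using (ℤ)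
open import Data.Rational using (ℚ; 0ℚ; 1ℚ; _/_) renaming (_+_ to _+ℚ_; _*_ to _*ℚ_; -_ to -ℚ_)
open import Data.Fin using (Fin; toℕ)
open import Data.Vec as Vec using (Vec; replicate; zipWith; lookup; _[_]≔_)
open import Data.Vec.Properties using (≡-dec)
open import Data.List as List using (List; []; _∷_; _++_; concatMap; map; allFin; foldr)
open import Data.Product using (_×_; _,_; ∃; ∃-syntax; Σ-syntax)
open import Data.Bool using (if_then_else_)
open import Relation.Nullary using (does)
open import Relation.Binary.PropositionalEquality using (_≡_)

IsPrimePower : ℕ → Set
IsPrimePower q = ∃[ p ] ∃[ k ] (Prime p × 1 ≤ k × q ≡ p ^ k)

-- Variable a_{i+1} corresponds to (i : Fin g).
-- A monomial is its exponent vector; a polynomial is a finite list of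
-- (coefficient, monomial) terms (possibly with repetitions); its
-- coefficient at a monomial is the sum of the matching terms.

Mon : ℕ → Set
Mon g = Vec ℕ g

Poly : ℕ → Set
Poly g = List (ℚ × Mon g)

coeff : ∀ {g} → Poly g → Mon g → ℚ
coeff [] m = 0ℚ
coeff ((c , m') ∷ p) m =
  if does (≡-dec ℕ._≟_ m' m) then c +ℚ coeff p m else coeff p m

_≈P_ : ∀ {g} → Poly g → Poly g → Set
p ≈P p' = ∀ m → coeff p m ≡ coeff p' m

constP : ∀ {g} → ℚ → Poly g
constP {g} c = (c , replicate g 0) ∷ []

zeroP : ∀ {g} → Poly g
zeroP = []

var : ∀ {g} → Fin g → Poly g
var {g} i = (1ℚ , (replicate g 0 [ i ]≔ 1)) ∷ []

_+P_ : ∀ {g} → Poly g → Poly g → Poly g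
_+P_ = _++_

_*P_ : ∀ {g} → Poly g → Poly g → Poly g
p *P p' = concatMap (λ { (c , m) → map (λ { (c' , m') → (c *ℚ c' , zipWith ℕ._+_ m m') }) p' }) p

negP : ∀ {g} → Poly g → Poly g
negP p = map (λ { (c , m) → (-ℚ c , m) }) p

ℕtoℚ : ℕ → ℚ
ℕtoℚ n = ℤ.+ n / 1

ΣP : ∀ {g} → ℕ → (ℕ → Poly g) → Poly g
ΣP zero f = f 0
ΣP (suc n) f = ΣP n f +P f (suc n)

falling : ∀ {g} → Poly g → ℕ → Poly g
falling x zero = constP 1ℚ
falling x (suc j) = falling x j *P (x +P constP (-ℚ (ℕtoℚ j)))

binomP : ∀ {g} → Poly g → ℕ → Poly g
binomP x j = constP ((ℤ.+ 1 / (j !)) {{j !≢0}}) *P falling x j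

signℚ : ℕ → ℚ
signℚ zero = 1ℚ
signℚ (suc j) = -ℚ (signℚ j)

Series : ℕ → Set
Series g = ℕ → Poly g

_*S_ : ∀ {g} → Series g → Series g → Series g
(f *S h) n = ΣP n (λ k → f k *P h (n ∸ k))

oneS : ∀ {g} → Series g
oneS zero = constP 1ℚ
oneS (suc n) = zeroP

-- (1 - t)(1 - q t) = 1 - (1+q) t + q t²
prefactor : ∀ {g} → ℕ → Series g
prefactor q 0 = constP 1ℚ
prefactor q 1 = constP (-ℚ (ℕtoℚ (suc q)))
prefactor q 2 = constP (ℕtoℚ q)
prefactor q (suc (suc (suc n))) = zeroP

-- (1 - t^d)^{-a} := Σ_{j≥0} binom(-a, j) (-t^d)^j, for d ≥ 1:
-- coefficient of t^n is Σ_{j ≤ n, d j = n} binom(-a,j) (-1)^j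
powSeries : ∀ {g} → ℕ → Poly g → Series g
powSeries d a n =
  ΣP n (λ j → if does (d ℕ.* j ℕ.≟ n)
                then binomP (negP a) j *P constP (signℚ j)
                else zeroP)

-- factor for variable i : Fin g, i.e. d = toℕ i + 1, a = a_d
factor : ∀ {g} → Fin g → Series g
factor i = powSeries (suc (toℕ i)) (var i)

zetaSeries : (q g : ℕ) → Series g
zetaSeries q g = prefactor q *S foldr (λ i s → factor i *S s) oneS (allFin g)

A : (q g : ℕ) → ℕ → Poly g
A q g n = zetaSeries q g n

triRHS : (q g : ℕ) → (ℕ → Poly g) → ℕ → Poly g
triRHS q g H n =
  ΣP n (λ k → if does ((n ∸ k) % 2 ℕ.≟ 0)
                then H k *P constP (ℕtoℚ (((g ∸ k) C ((n ∸ k) ℕ./ 2)) ℕ.* (q ^ ((n ∸ k) ℕ./ 2))))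
                else zeroP)

-- Give the variable a_d the weight d.  The coefficient of t^n in each factor
-- (1 - t^d)^(-a_d), and hence A_n, only involves monomials of weight at most n.
-- The triangular system writes H_n as A_n minus multiples of H_k with k < n, so by
-- induction H_n too only involves monomials of weight at most n; such a monomial
-- cannot contain a_j for j > n and contains a_n at most to the first power.
-- For the same reason the coefficient of a_n in H_n is its coefficient in A_n.  All
-- factors have constant term 1 and weights keep lower powers of t from contributing,
-- so the coefficient of a_n t^n in the product is the sum of those in the factors:
-- 0 for the prefactor and for (1 - t^d)^(-a_d) with d ≠ n, and 1 for (1 - t^n)^(-a_n),
-- whose coefficient of t^n is binom(-a_n, 1) (-1) = a_n.

module Submission where

open import Defs
open import Data.Nat using (ℕ; suc; _≤_; _<_)
open import Data.Fin using (Fin; toℕ)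
open import Data.Vec using (lookup)
open import Data.Rational using (0ℚ)
open import Data.Product using (_×_; ∃-syntax)
open import Relation.Binary.PropositionalEquality using (_≡_; _≢_)

open import Algebra using (CommutativeMonoid)
import Algebra.Properties.CommutativeSemigroup as CommSemigroupProperties
open import Data.Bool using (true; false; if_then_else_)
open import Data.Empty using (⊥-elim)
open import Function using (_∘_)
import Data.Fin as Fin
import Data.Fin.Properties as FinP
open import Data.List using (List; []; _∷_; _++_; map; foldr; allFin)
open import Data.List.Membership.Propositional using (_∈_; _∉_)
open import Data.List.Membership.Propositional.Properties using (∈-allFin)
open import Data.List.Relation.Unary.All as All using (All; []; _∷_)
open import Data.List.Relation.Unary.All.Properties using (++⁺; map⁺; concat⁺; All¬⇒¬Any)
open import Data.List.Relation.Unary.Any using (here; there)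
open import Data.List.Relation.Unary.Unique.Propositional using (Unique; _∷_)
open import Data.List.Relation.Unary.Unique.Propositional.Properties using (allFin⁺)
open import Data.Nat as ℕ using (zero; z≤n; s≤s; _∸_; _!)
import Data.Integer as ℤ
open import Data.Nat.Combinatorics using (_C_)
open import Data.Nat.Induction using (<-rec)
import Data.Nat.Properties as ℕP
open ℕP using (_!≢0)
open import Data.Product using (_,_; proj₁; proj₂)
open import Data.Rational as ℚ using (ℚ; 1ℚ; _+_; _*_; -_)
import Data.Rational.Properties as ℚP
open import Data.Rational.Solver using (module +-*-Solver)
open +-*-Solver using (solve; _:=_; _:+_; _:*_; :-_; con)
open import Data.Sum using (_⊎_; inj₁; inj₂)
open import Data.Vec using ([]; _∷_; replicate; zipWith; _[_]≔_)
import Data.Vec.Properties as VecP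
open VecP using (≡-dec)
open import Relation.Nullary using (Dec; yes; no; ¬_; does)
open import Relation.Binary.PropositionalEquality
  using (refl; sym; trans; cong; cong₂; subst; module ≡-Reasoning)

private
  variable
    g : ℕ

-- Coefficient calculus

0ᴹ : Mon g
0ᴹ {g} = replicate g 0

varMon : Fin g → Mon g
varMon {g} i = replicate g 0 [ i ]≔ 1

infixl 6 _+ᴹ_
_+ᴹ_ : Mon g → Mon g → Mon g
_+ᴹ_ = zipWith ℕ._+_

+ᴹ-identityˡ : (m : Mon g) → 0ᴹ +ᴹ m ≡ m
+ᴹ-identityˡ = VecP.zipWith-identityˡ ℕP.+-identityˡ

+ᴹ-identityʳ : (m : Mon g) → m +ᴹ 0ᴹ ≡ m
+ᴹ-identityʳ = VecP.zipWith-identityʳ ℕP.+-identityʳ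

+ᴹ-cancelˡ : (m a b : Mon g) → m +ᴹ a ≡ m +ᴹ b → a ≡ b
+ᴹ-cancelˡ [] [] [] _ = refl
+ᴹ-cancelˡ (x ∷ m) (y ∷ a) (z ∷ b) eq =
  cong₂ _∷_ (ℕP.+-cancelˡ-≡ x y z (VecP.∷-injectiveˡ eq)) (+ᴹ-cancelˡ m a b (VecP.∷-injectiveʳ eq))

+ᴹ-conicalˡ : (a b : Mon g) → a +ᴹ b ≡ 0ᴹ → a ≡ 0ᴹ
+ᴹ-conicalˡ [] [] _ = refl
+ᴹ-conicalˡ (x ∷ a) (y ∷ b) eq =
  cong₂ _∷_ (ℕP.m+n≡0⇒m≡0 x (VecP.∷-injectiveˡ eq)) (+ᴹ-conicalˡ a b (VecP.∷-injectiveʳ eq))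

+ᴹ-≡varMon : (v : Fin g) (a b : Mon g) → a +ᴹ b ≡ varMon v → a ≡ 0ᴹ ⊎ a ≡ varMon v
+ᴹ-≡varMon Fin.zero (x ∷ a) (y ∷ b) eq
  with VecP.∷-injectiveˡ eq | +ᴹ-conicalˡ a b (VecP.∷-injectiveʳ eq)
... | x+y≡1 | refl with x
...   | 0 = inj₁ refl
...   | 1 = inj₂ refl
...   | suc (suc _) with () ← x+y≡1
+ᴹ-≡varMon (Fin.suc v) (x ∷ a) (y ∷ b) eq
  with ℕP.m+n≡0⇒m≡0 x (VecP.∷-injectiveˡ eq) | +ᴹ-≡varMon v a b (VecP.∷-injectiveʳ eq)
... | refl | inj₁ refl = inj₁ refl
... | refl | inj₂ refl = inj₂ refl

varMon≢0ᴹ : (v : Fin g) → varMon v ≢ 0ᴹ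
varMon≢0ᴹ (Fin.suc v) eq = varMon≢0ᴹ v (VecP.∷-injectiveʳ eq)

varMon-injective : (i v : Fin g) → varMon i ≡ varMon v → i ≡ v
varMon-injective Fin.zero    Fin.zero    _  = refl
varMon-injective (Fin.suc i) (Fin.suc v) eq = cong Fin.suc (varMon-injective i v (VecP.∷-injectiveʳ eq))
varMon-injective Fin.zero    (Fin.suc v) ()
varMon-injective (Fin.suc i) Fin.zero    ()

coeff-++ : (p p′ : Poly g) (m : Mon g) → coeff (p ++ p′) m ≡ coeff p m + coeff p′ m
coeff-++ [] p′ m = sym (ℚP.+-identityˡ _)
coeff-++ ((c , m′) ∷ p) p′ m with does (≡-dec ℕ._≟_ m′ m)
... | true  = trans (cong (c +_) (coeff-++ p p′ m)) (sym (ℚP.+-assoc c _ _))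
... | false = coeff-++ p p′ m

coeff-negP : (p : Poly g) (m : Mon g) → coeff (negP p) m ≡ - coeff p m
coeff-negP [] m = refl
coeff-negP ((c , m′) ∷ p) m with does (≡-dec ℕ._≟_ m′ m)
... | true  = trans (cong (- c +_) (coeff-negP p m)) (sym (ℚP.neg-distrib-+ c _))
... | false = coeff-negP p m

coeff-constP-0ᴹ : (c : ℚ) → coeff {g} (constP c) 0ᴹ ≡ c
coeff-constP-0ᴹ {g} c with ≡-dec ℕ._≟_ (0ᴹ {g}) 0ᴹ
... | yes _   = ℚP.+-identityʳ c
... | no 0≢0 = ⊥-elim (0≢0 refl)

coeff-constP-≢ : (c : ℚ) {m : Mon g} → 0ᴹ ≢ m → coeff (constP c) m ≡ 0ℚ
coeff-constP-≢ c {m} 0≢m with ≡-dec ℕ._≟_ 0ᴹ m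
... | yes 0≡m = ⊥-elim (0≢m 0≡m)
... | no _    = refl

coeff-constP-0ℚ : (m : Mon g) → coeff (constP 0ℚ) m ≡ 0ℚ
coeff-constP-0ℚ m with does (≡-dec ℕ._≟_ 0ᴹ m)
... | true  = refl
... | false = refl

coeff-var-varMon : (v : Fin g) → coeff (var v) (varMon v) ≡ 1ℚ
coeff-var-varMon v with ≡-dec ℕ._≟_ (varMon v) (varMon v)
... | yes _ = ℚP.+-identityʳ 1ℚ
... | no ≢ = ⊥-elim (≢ refl)

coeff-var-varMon-≢ : {i v : Fin g} → i ≢ v → coeff (var i) (varMon v) ≡ 0ℚ
coeff-var-varMon-≢ {i = i} {v} i≢v with ≡-dec ℕ._≟_ (varMon i) (varMon v)
... | yes eq = ⊥-elim (i≢v (varMon-injective i v eq))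
... | no _   = refl

if-yes : ∀ {P : Set} (D : Dec P) {p : Poly g} → P → (if does D then p else zeroP) ≡ p
if-yes (yes _) _ = refl
if-yes (no ¬P) P = ⊥-elim (¬P P)

if-no : ∀ {P : Set} (D : Dec P) {p : Poly g} → ¬ P → (if does D then p else zeroP) ≡ zeroP
if-no (yes P) ¬P = ⊥-elim (¬P P)
if-no (no _)  _  = refl

coeff-if-≡0 : ∀ {P : Set} (D : Dec P) {p : Poly g} {m : Mon g} → coeff p m ≡ 0ℚ →
              coeff (if does D then p else zeroP) m ≡ 0ℚ
coeff-if-≡0 (yes _) p≡0 = p≡0
coeff-if-≡0 (no _)  _   = refl

-- The term (c , m₁) of p contributes  map f p′  to  p *P p′, with f the anonymous
-- function in the definition of _*P_.
module _ (c : ℚ) (m₁ : Mon g) {f : ℚ × Mon g → ℚ × Mon g}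
         (f-spec : ∀ c′ m₂ → f (c′ , m₂) ≡ (c * c′ , m₁ +ᴹ m₂)) where

  coeff-row-shift : {m m′ : Mon g} → m₁ +ᴹ m′ ≡ m → (p′ : Poly g) →
                    coeff (map f p′) m ≡ c * coeff p′ m′
  coeff-row-shift eq [] = sym (ℚP.*-zeroʳ c)
  coeff-row-shift {m} {m′} eq ((c′ , m₂) ∷ p′) rewrite f-spec c′ m₂
    with ≡-dec ℕ._≟_ (m₁ +ᴹ m₂) m | ≡-dec ℕ._≟_ m₂ m′
  ... | yes _ | yes _ = trans (cong (c * c′ +_) (coeff-row-shift eq p′)) (sym (ℚP.*-distribˡ-+ c c′ _))
  ... | yes eq′ | no m₂≢m′ = ⊥-elim (m₂≢m′ (+ᴹ-cancelˡ m₁ m₂ m′ (trans eq′ (sym eq))))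
  ... | no ≢m | yes refl = ⊥-elim (≢m eq)
  ... | no _  | no _     = coeff-row-shift eq p′

  coeff-row-none : {m : Mon g} → (∀ m₂ → m₁ +ᴹ m₂ ≢ m) → (p′ : Poly g) → coeff (map f p′) m ≡ 0ℚ
  coeff-row-none none [] = refl
  coeff-row-none {m} none ((c′ , m₂) ∷ p′) rewrite f-spec c′ m₂ with ≡-dec ℕ._≟_ (m₁ +ᴹ m₂) m
  ... | yes eq = ⊥-elim (none m₂ eq)
  ... | no _   = coeff-row-none none p′

coeff-*P-0ᴹ : (p p′ : Poly g) → coeff (p *P p′) 0ᴹ ≡ coeff p 0ᴹ * coeff p′ 0ᴹ
coeff-*P-0ᴹ [] p′ = sym (ℚP.*-zeroˡ (coeff p′ 0ᴹ))
coeff-*P-0ᴹ ((c , m₁) ∷ p) p′ with ≡-dec ℕ._≟_ m₁ 0ᴹ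
... | yes refl = begin
  coeff (map _ p′ ++ p *P p′) 0ᴹ
    ≡⟨ coeff-++ (map _ p′) (p *P p′) 0ᴹ ⟩
  coeff (map _ p′) 0ᴹ + coeff (p *P p′) 0ᴹ
    ≡⟨ cong₂ _+_ (coeff-row-shift c 0ᴹ (λ _ _ → refl) (+ᴹ-identityˡ 0ᴹ) p′) (coeff-*P-0ᴹ p p′) ⟩
  c * coeff p′ 0ᴹ + coeff p 0ᴹ * coeff p′ 0ᴹ
    ≡⟨ sym (ℚP.*-distribʳ-+ _ c _) ⟩
  (c + coeff p 0ᴹ) * coeff p′ 0ᴹ ∎
  where open ≡-Reasoning
... | no m₁≢0 = begin
  coeff (map _ p′ ++ p *P p′) 0ᴹ
    ≡⟨ coeff-++ (map _ p′) (p *P p′) 0ᴹ ⟩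
  coeff (map _ p′) 0ᴹ + coeff (p *P p′) 0ᴹ
    ≡⟨ cong₂ _+_ (coeff-row-none c m₁ (λ _ _ → refl) (λ m₂ eq → m₁≢0 (+ᴹ-conicalˡ m₁ m₂ eq)) p′)
                 (coeff-*P-0ᴹ p p′) ⟩
  0ℚ + coeff p 0ᴹ * coeff p′ 0ᴹ
    ≡⟨ ℚP.+-identityˡ _ ⟩
  coeff p 0ᴹ * coeff p′ 0ᴹ ∎
  where open ≡-Reasoning

coeff-*P-varMon : (v : Fin g) (p p′ : Poly g) →
  coeff (p *P p′) (varMon v) ≡ coeff p 0ᴹ * coeff p′ (varMon v) + coeff p (varMon v) * coeff p′ 0ᴹ
coeff-*P-varMon v [] p′ = sym (cong₂ _+_ (ℚP.*-zeroˡ (coeff p′ (varMon v))) (ℚP.*-zeroˡ (coeff p′ 0ᴹ)))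
coeff-*P-varMon v ((c , m₁) ∷ p) p′ with ≡-dec ℕ._≟_ m₁ 0ᴹ | ≡-dec ℕ._≟_ m₁ (varMon v)
... | yes refl | yes eq = ⊥-elim (varMon≢0ᴹ v (sym eq))
... | yes refl | no _ = begin
  coeff (map _ p′ ++ p *P p′) e
    ≡⟨ coeff-++ (map _ p′) (p *P p′) e ⟩
  coeff (map _ p′) e + coeff (p *P p′) e
    ≡⟨ cong₂ _+_ (coeff-row-shift c 0ᴹ (λ _ _ → refl) (+ᴹ-identityˡ e) p′) (coeff-*P-varMon v p p′) ⟩
  c * b₁ + (a₀ * b₁ + a₁ * b₀)
    ≡⟨ solve 5 (λ c a₀ a₁ b₀ b₁ → c :* b₁ :+ (a₀ :* b₁ :+ a₁ :* b₀) := (c :+ a₀) :* b₁ :+ a₁ :* b₀)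
               refl c a₀ a₁ b₀ b₁ ⟩
  (c + a₀) * b₁ + a₁ * b₀ ∎
  where open ≡-Reasoning
        e = varMon v
        a₀ = coeff p 0ᴹ
        a₁ = coeff p e
        b₀ = coeff p′ 0ᴹ
        b₁ = coeff p′ e
... | no _ | yes refl = begin
  coeff (map _ p′ ++ p *P p′) e
    ≡⟨ coeff-++ (map _ p′) (p *P p′) e ⟩
  coeff (map _ p′) e + coeff (p *P p′) e
    ≡⟨ cong₂ _+_ (coeff-row-shift c e (λ _ _ → refl) (+ᴹ-identityʳ e) p′) (coeff-*P-varMon v p p′) ⟩
  c * b₀ + (a₀ * b₁ + a₁ * b₀)
    ≡⟨ solve 5 (λ c a₀ a₁ b₀ b₁ → c :* b₀ :+ (a₀ :* b₁ :+ a₁ :* b₀) := a₀ :* b₁ :+ (c :+ a₁) :* b₀)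
               refl c a₀ a₁ b₀ b₁ ⟩
  a₀ * b₁ + (c + a₁) * b₀ ∎
  where open ≡-Reasoning
        e = varMon v
        a₀ = coeff p 0ᴹ
        a₁ = coeff p e
        b₀ = coeff p′ 0ᴹ
        b₁ = coeff p′ e
... | no m₁≢0 | no m₁≢e = begin
  coeff (map _ p′ ++ p *P p′) e
    ≡⟨ coeff-++ (map _ p′) (p *P p′) e ⟩
  coeff (map _ p′) e + coeff (p *P p′) e
    ≡⟨ cong₂ _+_ (coeff-row-none c m₁ (λ _ _ → refl) not-summand p′) (coeff-*P-varMon v p p′) ⟩
  0ℚ + (coeff p 0ᴹ * coeff p′ e + coeff p e * coeff p′ 0ᴹ)
    ≡⟨ ℚP.+-identityˡ _ ⟩
  coeff p 0ᴹ * coeff p′ e + coeff p e * coeff p′ 0ᴹ ∎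
  where open ≡-Reasoning
        e = varMon v
        not-summand : ∀ m₂ → m₁ +ᴹ m₂ ≢ e
        not-summand m₂ eq with +ᴹ-≡varMon v m₁ m₂ eq
        ... | inj₁ m₁≡0 = m₁≢0 m₁≡0
        ... | inj₂ m₁≡e = m₁≢e m₁≡e

coeff-constP-*P : (c : ℚ) (p : Poly g) (m : Mon g) → coeff (constP c *P p) m ≡ c * coeff p m
coeff-constP-*P c p m = begin
  coeff (map _ p ++ []) m      ≡⟨ coeff-++ (map _ p) [] m ⟩
  coeff (map _ p) m + 0ℚ       ≡⟨ ℚP.+-identityʳ _ ⟩
  coeff (map _ p) m            ≡⟨ coeff-row-shift c 0ᴹ (λ _ _ → refl) (+ᴹ-identityˡ m) p ⟩
  c * coeff p m                ∎
  where open ≡-Reasoning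

coeff-*P-constP : (p : Poly g) (c : ℚ) (m : Mon g) → coeff (p *P constP c) m ≡ coeff p m * c
coeff-*P-constP [] c m = sym (ℚP.*-zeroˡ c)
coeff-*P-constP ((c₀ , m₀) ∷ p) c m rewrite +ᴹ-identityʳ m₀ with does (≡-dec ℕ._≟_ m₀ m)
... | true  = trans (cong (c₀ * c +_) (coeff-*P-constP p c m)) (sym (ℚP.*-distribʳ-+ c c₀ _))
... | false = coeff-*P-constP p c m

Σℚ : ℕ → (ℕ → ℚ) → ℚ
Σℚ zero    f = f 0
Σℚ (suc n) f = Σℚ n f + f (suc n)

coeff-ΣP : ∀ n (f : ℕ → Poly g) (m : Mon g) → coeff (ΣP n f) m ≡ Σℚ n (λ k → coeff (f k) m)
coeff-ΣP zero    f m = refl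
coeff-ΣP (suc n) f m = trans (coeff-++ (ΣP n f) (f (suc n)) m) (cong (_+ coeff (f (suc n)) m) (coeff-ΣP n f m))

Σℚ-cong : ∀ n {f h : ℕ → ℚ} → (∀ k → f k ≡ h k) → Σℚ n f ≡ Σℚ n h
Σℚ-cong zero    f≗h = f≗h 0
Σℚ-cong (suc n) f≗h = cong₂ _+_ (Σℚ-cong n f≗h) (f≗h (suc n))

Σℚ-+ : ∀ n (f h : ℕ → ℚ) → Σℚ n (λ k → f k + h k) ≡ Σℚ n f + Σℚ n h
Σℚ-+ zero    f h = refl
Σℚ-+ (suc n) f h = trans (cong (_+ (f (suc n) + h (suc n))) (Σℚ-+ n f h))
                          (interchange (Σℚ n f) (Σℚ n h) (f (suc n)) (h (suc n)))
  where open CommSemigroupProperties (CommutativeMonoid.commutativeSemigroup ℚP.+-0-commutativeMonoid)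

Σℚ-≡0 : ∀ n (f : ℕ → ℚ) → (∀ k → k ≤ n → f k ≡ 0ℚ) → Σℚ n f ≡ 0ℚ
Σℚ-≡0 zero    f f≡0 = f≡0 0 z≤n
Σℚ-≡0 (suc n) f f≡0 =
  cong₂ _+_ (Σℚ-≡0 n f (λ k k≤n → f≡0 k (ℕP.m≤n⇒m≤1+n k≤n))) (f≡0 (suc n) ℕP.≤-refl)

Σℚ-single : ∀ n (f : ℕ → ℚ) {j} → j ≤ n → (∀ k → k ≤ n → k ≢ j → f k ≡ 0ℚ) → Σℚ n f ≡ f j
Σℚ-single zero    f z≤n _ = refl
Σℚ-single (suc n) f {j} j≤1+n others with j ℕ.≟ suc n
... | yes refl = trans (cong (_+ f (suc n))
                         (Σℚ-≡0 n f (λ k k≤n → others k (ℕP.m≤n⇒m≤1+n k≤n) (ℕP.<⇒≢ (s≤s k≤n)))))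
                       (ℚP.+-identityˡ _)
... | no j≢1+n = trans (cong₂ _+_ (Σℚ-single n f (ℕP.≤-pred (ℕP.≤∧≢⇒< j≤1+n j≢1+n))
                                      (λ k k≤n → others k (ℕP.m≤n⇒m≤1+n k≤n)))
                                  (others (suc n) ℕP.≤-refl (j≢1+n ∘ sym)))
                       (ℚP.+-identityʳ _)

-- Weights

-- The variable a_d (index d - 1) has weight d; weightFrom o shifts all weights by o.
weightFrom : ℕ → Mon g → ℕ
weightFrom o []      = 0
weightFrom o (x ∷ m) = suc o ℕ.* x ℕ.+ weightFrom (suc o) m

weight : Mon g → ℕ
weight = weightFrom 0

weightFrom-+ᴹ : ∀ o (a b : Mon g) → weightFrom o (a +ᴹ b) ≡ weightFrom o a ℕ.+ weightFrom o b
weightFrom-+ᴹ o []      []      = refl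
weightFrom-+ᴹ o (x ∷ a) (y ∷ b) = begin
  suc o ℕ.* (x ℕ.+ y) ℕ.+ weightFrom (suc o) (a +ᴹ b)
    ≡⟨ cong₂ ℕ._+_ (ℕP.*-distribˡ-+ (suc o) x y) (weightFrom-+ᴹ (suc o) a b) ⟩
  (suc o ℕ.* x ℕ.+ suc o ℕ.* y) ℕ.+ (weightFrom (suc o) a ℕ.+ weightFrom (suc o) b)
    ≡⟨ interchange (suc o ℕ.* x) (suc o ℕ.* y) _ _ ⟩
  (suc o ℕ.* x ℕ.+ weightFrom (suc o) a) ℕ.+ (suc o ℕ.* y ℕ.+ weightFrom (suc o) b) ∎
  where open ≡-Reasoning
        open CommSemigroupProperties ℕP.+-commutativeSemigroup

weightFrom-0ᴹ : ∀ o → weightFrom o (0ᴹ {g}) ≡ 0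
weightFrom-0ᴹ {zero}  o = refl
weightFrom-0ᴹ {suc g} o = cong₂ ℕ._+_ (ℕP.*-zeroʳ (suc o)) (weightFrom-0ᴹ {g} (suc o))

weightFrom-varMon : ∀ o (v : Fin g) → weightFrom o (varMon v) ≡ suc (o ℕ.+ toℕ v)
weightFrom-varMon {suc g} o Fin.zero =
  cong₂ ℕ._+_ (ℕP.*-identityʳ (suc o)) (weightFrom-0ᴹ {g} (suc o))
weightFrom-varMon {suc g} o (Fin.suc v) = begin
  suc o ℕ.* 0 ℕ.+ weightFrom (suc o) (varMon v)
    ≡⟨ cong₂ ℕ._+_ (ℕP.*-zeroʳ (suc o)) (weightFrom-varMon (suc o) v) ⟩
  suc (suc o ℕ.+ toℕ v)
    ≡⟨ cong suc (sym (ℕP.+-suc o (toℕ v))) ⟩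
  suc (o ℕ.+ suc (toℕ v)) ∎
  where open ≡-Reasoning

weight-varMon : (v : Fin g) → weight (varMon v) ≡ suc (toℕ v)
weight-varMon = weightFrom-varMon 0

<-weight-varMon : {k : ℕ} (v : Fin g) → k < suc (toℕ v) → k < weight (varMon v)
<-weight-varMon v k<v = ℕP.<-≤-trans k<v (ℕP.≤-reflexive (sym (weight-varMon v)))

lookup-weightFrom : ∀ o (m : Mon g) (j : Fin g) → suc (o ℕ.+ toℕ j) ℕ.* lookup m j ≤ weightFrom o m
lookup-weightFrom o (x ∷ m) Fin.zero    rewrite ℕP.+-identityʳ o = ℕP.m≤m+n _ _
lookup-weightFrom o (x ∷ m) (Fin.suc j) rewrite ℕP.+-suc o (toℕ j) =
  ℕP.≤-trans (lookup-weightFrom (suc o) m j) (ℕP.m≤n+m _ _)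

Weight≤ : ℕ → Poly g → Set
Weight≤ w = All (λ t → weight (proj₂ t) ≤ w)

weight≤-mono : {p : Poly g} {w w′ : ℕ} → w ≤ w′ → Weight≤ w p → Weight≤ w′ p
weight≤-mono w≤w′ = All.map (λ ≤w → ℕP.≤-trans ≤w w≤w′)

weight≤-negP : {p : Poly g} {w : ℕ} → Weight≤ w p → Weight≤ w (negP p)
weight≤-negP = map⁺

weight≤-constP : (c : ℚ) → Weight≤ 0 (constP {g} c)
weight≤-constP {g} c = ℕP.≤-reflexive (weightFrom-0ᴹ {g} 0) ∷ []

weight≤-var : (i : Fin g) → Weight≤ (suc (toℕ i)) (var i)
weight≤-var i = ℕP.≤-reflexive (weightFrom-varMon 0 i) ∷ []

weight≤-*P : {p p′ : Poly g} {a b : ℕ} → Weight≤ a p → Weight≤ b p′ → Weight≤ (a ℕ.+ b) (p *P p′)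
weight≤-*P {p′ = p′} {a} {b} wp wp′ = concat⁺ (map⁺ (All.map (λ {t} → row (proj₁ t) (proj₂ t)) wp))
  where
    row : ∀ c m₁ → weight m₁ ≤ a → Weight≤ (a ℕ.+ b) (map (λ t → (c * proj₁ t , m₁ +ᴹ proj₂ t)) p′)
    row c m₁ ≤a = map⁺ (All.map (λ {t} ≤b →
      ℕP.≤-trans (ℕP.≤-reflexive (weightFrom-+ᴹ 0 m₁ (proj₂ t))) (ℕP.+-mono-≤ ≤a ≤b)) wp′)

weight≤-ΣP : ∀ n (f : ℕ → Poly g) {w : ℕ} → (∀ k → k ≤ n → Weight≤ w (f k)) → Weight≤ w (ΣP n f)
weight≤-ΣP zero    f wf = wf 0 z≤n
weight≤-ΣP (suc n) f wf = ++⁺ (weight≤-ΣP n f (λ k k≤n → wf k (ℕP.m≤n⇒m≤1+n k≤n))) (wf (suc n) ℕP.≤-refl)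

weight≤-if : ∀ {P : Set} (D : Dec P) {p : Poly g} {w : ℕ} → (P → Weight≤ w p) →
             Weight≤ w (if does D then p else zeroP)
weight≤-if (yes P) wp = wp P
weight≤-if (no _)  _  = []

coeff-weight> : (p : Poly g) {w : ℕ} {m : Mon g} → Weight≤ w p → w < weight m → coeff p m ≡ 0ℚ
coeff-weight> [] [] _ = refl
coeff-weight> ((c , m′) ∷ p) {m = m} (≤w ∷ wp) w<m with ≡-dec ℕ._≟_ m′ m
... | yes refl = ⊥-elim (ℕP.<⇒≱ w<m ≤w)
... | no _     = coeff-weight> p wp w<m

WeightGraded : Series g → Set
WeightGraded s = ∀ n → Weight≤ n (s n)

*S-weightGraded : {f h : Series g} → WeightGraded f → WeightGraded h → WeightGraded (f *S h)
*S-weightGraded {f = f} {h} wf wh n = weight≤-ΣP n (λ k → f k *P h (n ∸ k))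
  (λ k k≤n → weight≤-mono (ℕP.≤-reflexive (ℕP.m+[n∸m]≡n k≤n)) (weight≤-*P (wf k) (wh (n ∸ k))))

oneS-weightGraded : WeightGraded (oneS {g})
oneS-weightGraded zero    = weight≤-constP 1ℚ
oneS-weightGraded (suc n) = []

prefactor-weight≤0 : ∀ q n → Weight≤ 0 (prefactor {g} q n)
prefactor-weight≤0 q 0                   = weight≤-constP _
prefactor-weight≤0 q 1                   = weight≤-constP _
prefactor-weight≤0 q 2                   = weight≤-constP _
prefactor-weight≤0 q (suc (suc (suc n))) = []

falling-weight≤ : {x : Poly g} {d : ℕ} → Weight≤ d x → ∀ j → Weight≤ (d ℕ.* j) (falling x j)
falling-weight≤ wx zero    = weight≤-mono z≤n (weight≤-constP 1ℚ)
falling-weight≤ {d = d} wx (suc j) =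
  weight≤-mono (ℕP.≤-reflexive (trans (ℕP.+-comm (d ℕ.* j) d) (sym (ℕP.*-suc d j))))
        (weight≤-*P (falling-weight≤ wx j) (++⁺ wx (weight≤-mono z≤n (weight≤-constP _))))

1/_! : ℕ → ℚ
1/ j ! = (ℤ.+ 1 ℚ./ j !) {{j !≢0}}

binomP-weight≤ : {x : Poly g} {d : ℕ} → Weight≤ d x → ∀ j → Weight≤ (d ℕ.* j) (binomP x j)
binomP-weight≤ wx j = weight≤-*P (weight≤-constP (1/ j !)) (falling-weight≤ wx j)

powSeries-weightGraded : ∀ d (a : Poly g) → Weight≤ d a → WeightGraded (powSeries d a)
powSeries-weightGraded d a wa n = weight≤-ΣP n _ λ j _ → weight≤-if (d ℕ.* j ℕ.≟ n) λ dj≡n →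
  weight≤-mono (ℕP.≤-reflexive (trans (ℕP.+-identityʳ _) dj≡n))
    (weight≤-*P (binomP-weight≤ (weight≤-negP wa) j) (weight≤-constP (signℚ j)))

factor-weightGraded : (i : Fin g) → WeightGraded (factor i)
factor-weightGraded i = powSeries-weightGraded (suc (toℕ i)) (var i) (weight≤-var i)

factorProduct : List (Fin g) → Series g
factorProduct = foldr (λ i s → factor i *S s) oneS

factorProduct-weightGraded : (l : List (Fin g)) → WeightGraded (factorProduct l)
factorProduct-weightGraded []      = oneS-weightGraded
factorProduct-weightGraded (i ∷ l) =
  *S-weightGraded (factor-weightGraded i) (factorProduct-weightGraded l)

prefactor-weightGraded : ∀ q → WeightGraded (prefactor {g} q)
prefactor-weightGraded q n = weight≤-mono z≤n (prefactor-weight≤0 q n)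

A-weight≤ : ∀ q g n → Weight≤ n (A q g n)
A-weight≤ q g = *S-weightGraded (prefactor-weightGraded q) (factorProduct-weightGraded (allFin g))

-- Linear coefficients of the zeta series

-- varMon v has weight n, so of the Leibniz expansions of the summands f k *P h (n ∸ k)
-- only the terms through h n (for k = 0) and through f n (for k = n) survive.
coeff-*S-varMon : {f h : Series g} → WeightGraded f → WeightGraded h → (v : Fin g) →
  let n = suc (toℕ v) in
  coeff ((f *S h) n) (varMon v) ≡ coeff (f 0) 0ᴹ * coeff (h n) (varMon v) + coeff (f n) (varMon v) * coeff (h 0) 0ᴹ
coeff-*S-varMon {f = f} {h} wf wh v = begin
  coeff ((f *S h) n) e
    ≡⟨ coeff-ΣP n (λ k → f k *P h (n ∸ k)) e ⟩
  Σℚ n (λ k → coeff (f k *P h (n ∸ k)) e)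
    ≡⟨ Σℚ-cong n (λ k → coeff-*P-varMon v (f k) (h (n ∸ k))) ⟩
  Σℚ n (λ k → coeff (f k) 0ᴹ * coeff (h (n ∸ k)) e + coeff (f k) e * coeff (h (n ∸ k)) 0ᴹ)
    ≡⟨ Σℚ-+ n _ _ ⟩
  Σℚ n (λ k → coeff (f k) 0ᴹ * coeff (h (n ∸ k)) e) + Σℚ n (λ k → coeff (f k) e * coeff (h (n ∸ k)) 0ᴹ)
    ≡⟨ cong₂ _+_ (Σℚ-single n _ z≤n h-too-light) (Σℚ-single n _ ℕP.≤-refl f-too-light) ⟩
  coeff (f 0) 0ᴹ * coeff (h n) e + coeff (f n) e * coeff (h (n ∸ n)) 0ᴹ
    ≡⟨ cong (λ k → coeff (f 0) 0ᴹ * coeff (h n) e + coeff (f n) e * coeff (h k) 0ᴹ) (ℕP.n∸n≡0 n) ⟩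
  coeff (f 0) 0ᴹ * coeff (h n) e + coeff (f n) e * coeff (h 0) 0ᴹ ∎
  where
    open ≡-Reasoning
    n = suc (toℕ v)
    e = varMon v
    h-too-light : ∀ k → k ≤ n → k ≢ 0 → coeff (f k) 0ᴹ * coeff (h (n ∸ k)) e ≡ 0ℚ
    h-too-light zero    _ 0≢0 = ⊥-elim (0≢0 refl)
    h-too-light (suc k) _ _   = trans (cong (coeff (f (suc k)) 0ᴹ *_)
      (coeff-weight> (h (n ∸ suc k)) (wh _) (<-weight-varMon v (s≤s (ℕP.m∸n≤m (toℕ v) k)))))
      (ℚP.*-zeroʳ (coeff (f (suc k)) 0ᴹ))
    f-too-light : ∀ k → k ≤ n → k ≢ n → coeff (f k) e * coeff (h (n ∸ k)) 0ᴹ ≡ 0ℚ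
    f-too-light k k≤n k≢n = trans (cong (_* coeff (h (n ∸ k)) 0ᴹ)
      (coeff-weight> (f k) (wf k) (<-weight-varMon v (ℕP.≤∧≢⇒< k≤n k≢n))))
      (ℚP.*-zeroˡ (coeff (h (n ∸ k)) 0ᴹ))

coeff-falling-varMon : (v : Fin g) {x : Poly g} → coeff x (varMon v) ≡ 0ℚ →
                       ∀ j → coeff (falling x j) (varMon v) ≡ 0ℚ
coeff-falling-varMon v x≡0 zero    = coeff-constP-≢ 1ℚ (varMon≢0ᴹ v ∘ sym)
coeff-falling-varMon v {x} x≡0 (suc j) = begin
  coeff (falling x j *P (x +P constP c)) e
    ≡⟨ coeff-*P-varMon v (falling x j) (x +P constP c) ⟩
  coeff (falling x j) 0ᴹ * coeff (x +P constP c) e + coeff (falling x j) e * coeff (x +P constP c) 0ᴹ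
    ≡⟨ cong₂ (λ a b → coeff (falling x j) 0ᴹ * a + b * coeff (x +P constP c) 0ᴹ)
             (trans (coeff-++ x (constP c) e) (cong₂ _+_ x≡0 (coeff-constP-≢ c (varMon≢0ᴹ v ∘ sym))))
             (coeff-falling-varMon v x≡0 j) ⟩
  coeff (falling x j) 0ᴹ * 0ℚ + 0ℚ * coeff (x +P constP c) 0ᴹ
    ≡⟨ cong₂ _+_ (ℚP.*-zeroʳ (coeff (falling x j) 0ᴹ)) (ℚP.*-zeroˡ (coeff (x +P constP c) 0ᴹ)) ⟩
  0ℚ ∎
  where open ≡-Reasoning
        e = varMon v
        c = - ℕtoℚ j

coeff-powSeries-0 : ∀ d (a : Poly g) → coeff (powSeries d a 0) 0ᴹ ≡ 1ℚ
coeff-powSeries-0 {g} d a = begin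
  coeff (powSeries d a 0) 0ᴹ
    ≡⟨ cong (λ p → coeff p 0ᴹ) (if-yes (d ℕ.* 0 ℕ.≟ 0) (ℕP.*-zeroʳ d)) ⟩
  coeff ((𝟙 *P 𝟙) *P 𝟙) 0ᴹ
    ≡⟨ coeff-*P-constP (𝟙 *P 𝟙) 1ℚ 0ᴹ ⟩
  coeff (𝟙 *P 𝟙) 0ᴹ * 1ℚ
    ≡⟨ cong (_* 1ℚ) (coeff-constP-*P 1ℚ 𝟙 0ᴹ) ⟩
  1ℚ * coeff 𝟙 0ᴹ * 1ℚ
    ≡⟨ cong (λ c → 1ℚ * c * 1ℚ) (coeff-constP-0ᴹ {g} 1ℚ) ⟩
  1ℚ ∎
  where open ≡-Reasoning
        𝟙 = constP {g} 1ℚ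

coeff-powSeries-varMon : ∀ d {a : Poly g} (v : Fin g) → coeff a (varMon v) ≡ 0ℚ →
                         ∀ n → coeff (powSeries d a n) (varMon v) ≡ 0ℚ
coeff-powSeries-varMon d {a} v a≡0 n =
  trans (coeff-ΣP n _ (varMon v)) (Σℚ-≡0 n _ λ j _ → coeff-if-≡0 (d ℕ.* j ℕ.≟ n) (begin
    coeff (binomP x j *P constP (signℚ j)) (varMon v)
      ≡⟨ coeff-*P-constP (binomP x j) (signℚ j) (varMon v) ⟩
    coeff (binomP x j) (varMon v) * signℚ j
      ≡⟨ cong (_* signℚ j) (coeff-constP-*P (1/ j !) (falling x j) (varMon v)) ⟩
    1/ j ! * coeff (falling x j) (varMon v) * signℚ j
      ≡⟨ cong (λ c → 1/ j ! * c * signℚ j) (coeff-falling-varMon v x≡0 j) ⟩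
    1/ j ! * 0ℚ * signℚ j
      ≡⟨ cong (_* signℚ j) (ℚP.*-zeroʳ (1/ j !)) ⟩
    0ℚ * signℚ j
      ≡⟨ ℚP.*-zeroˡ (signℚ j) ⟩
    0ℚ ∎))
  where open ≡-Reasoning
        x = negP a
        x≡0 : coeff x (varMon v) ≡ 0ℚ
        x≡0 = trans (coeff-negP a (varMon v)) (cong -_ a≡0)

-- Only the summand j = 1 survives, and binom(-a, 1) (-1) = a.
powSeries-tᵈ : ∀ d (a : Poly g) → powSeries (suc d) a (suc d) ≈P a
powSeries-tᵈ d a m = begin
  coeff (powSeries (suc d) a (suc d)) m
    ≡⟨ coeff-ΣP (suc d) _ m ⟩
  Σℚ (suc d) (λ j → coeff (term j) m)
    ≡⟨ Σℚ-single (suc d) _ (s≤s z≤n)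
         (λ j _ j≢1 → cong (λ p → coeff p m) (if-no (suc d ℕ.* j ℕ.≟ suc d) (j≢1 ∘ j≡1))) ⟩
  coeff (term 1) m
    ≡⟨ cong (λ p → coeff p m) (if-yes (suc d ℕ.* 1 ℕ.≟ suc d) (ℕP.*-identityʳ (suc d))) ⟩
  coeff (binomP (negP a) 1 *P constP (- 1ℚ)) m
    ≡⟨ coeff-*P-constP (binomP (negP a) 1) (- 1ℚ) m ⟩
  coeff (constP 1ℚ *P falling (negP a) 1) m * - 1ℚ
    ≡⟨ cong (_* - 1ℚ) (coeff-constP-*P 1ℚ (falling (negP a) 1) m) ⟩
  1ℚ * coeff (constP 1ℚ *P (negP a +P constP 0ℚ)) m * - 1ℚ
    ≡⟨ cong (λ c → 1ℚ * c * - 1ℚ) (coeff-constP-*P 1ℚ (negP a +P constP 0ℚ) m) ⟩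
  1ℚ * (1ℚ * coeff (negP a +P constP 0ℚ) m) * - 1ℚ
    ≡⟨ cong (λ c → 1ℚ * (1ℚ * c) * - 1ℚ) (coeff-++ (negP a) (constP 0ℚ) m) ⟩
  1ℚ * (1ℚ * (coeff (negP a) m + coeff (constP 0ℚ) m)) * - 1ℚ
    ≡⟨ cong₂ (λ c c′ → 1ℚ * (1ℚ * (c + c′)) * - 1ℚ) (coeff-negP a m) (coeff-constP-0ℚ m) ⟩
  1ℚ * (1ℚ * (- coeff a m + 0ℚ)) * - 1ℚ
    ≡⟨ solve 1 (λ x → con 1ℚ :* (con 1ℚ :* (:- x :+ con 0ℚ)) :* (:- con 1ℚ) := x) refl (coeff a m) ⟩
  coeff a m ∎
  where
    open ≡-Reasoning
    term : ℕ → Poly _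
    term j = if does (suc d ℕ.* j ℕ.≟ suc d) then binomP (negP a) j *P constP (signℚ j) else zeroP
    j≡1 : ∀ {j} → suc d ℕ.* j ≡ suc d → j ≡ 1
    j≡1 {j} eq = ℕP.*-cancelˡ-≡ j 1 (suc d) (trans eq (sym (ℕP.*-identityʳ (suc d))))

coeff-factorProduct-0 : (l : List (Fin g)) → coeff (factorProduct l 0) 0ᴹ ≡ 1ℚ
coeff-factorProduct-0 {g} []  = coeff-constP-0ᴹ {g} 1ℚ
coeff-factorProduct-0 (i ∷ l) = begin
  coeff (factor i 0 *P factorProduct l 0) 0ᴹ
    ≡⟨ coeff-*P-0ᴹ (factor i 0) (factorProduct l 0) ⟩
  coeff (factor i 0) 0ᴹ * coeff (factorProduct l 0) 0ᴹ
    ≡⟨ cong₂ _*_ (coeff-powSeries-0 (suc (toℕ i)) (var i)) (coeff-factorProduct-0 l) ⟩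
  1ℚ * 1ℚ ∎
  where open ≡-Reasoning

coeff-factorProduct-∷ : (i : Fin g) (l : List (Fin g)) (v : Fin g) → let n = suc (toℕ v) in
  coeff (factorProduct (i ∷ l) n) (varMon v) ≡ coeff (factor i n) (varMon v) + coeff (factorProduct l n) (varMon v)
coeff-factorProduct-∷ i l v = begin
  coeff ((factor i *S factorProduct l) n) e
    ≡⟨ coeff-*S-varMon (factor-weightGraded i) (factorProduct-weightGraded l) v ⟩
  coeff (factor i 0) 0ᴹ * coeff (factorProduct l n) e + coeff (factor i n) e * coeff (factorProduct l 0) 0ᴹ
    ≡⟨ cong₂ (λ a b → a * coeff (factorProduct l n) e + coeff (factor i n) e * b)
             (coeff-powSeries-0 (suc (toℕ i)) (var i)) (coeff-factorProduct-0 l) ⟩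
  1ℚ * coeff (factorProduct l n) e + coeff (factor i n) e * 1ℚ
    ≡⟨ solve 2 (λ x y → con 1ℚ :* x :+ y :* con 1ℚ := y :+ x) refl
               (coeff (factorProduct l n) e) (coeff (factor i n) e) ⟩
  coeff (factor i n) e + coeff (factorProduct l n) e ∎
  where open ≡-Reasoning
        n = suc (toℕ v)
        e = varMon v

coeff-factorProduct-∉ : (v : Fin g) {l : List (Fin g)} → v ∉ l →
                        coeff (factorProduct l (suc (toℕ v))) (varMon v) ≡ 0ℚ
coeff-factorProduct-∉ v {[]}    _   = refl
coeff-factorProduct-∉ v {i ∷ l} v∉l = begin
  coeff (factorProduct (i ∷ l) n) (varMon v)
    ≡⟨ coeff-factorProduct-∷ i l v ⟩
  coeff (factor i n) (varMon v) + coeff (factorProduct l n) (varMon v)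
    ≡⟨ cong₂ _+_ (coeff-powSeries-varMon (suc (toℕ i)) {var i} v (coeff-var-varMon-≢ (v∉l ∘ here ∘ sym)) n)
                 (coeff-factorProduct-∉ v (v∉l ∘ there)) ⟩
  0ℚ + 0ℚ ∎
  where open ≡-Reasoning
        n = suc (toℕ v)

coeff-factorProduct-∈ : (v : Fin g) {l : List (Fin g)} → Unique l → v ∈ l →
                        coeff (factorProduct l (suc (toℕ v))) (varMon v) ≡ 1ℚ
coeff-factorProduct-∈ v {i ∷ l} (i∉l ∷ _) (here refl) = begin
  coeff (factorProduct (i ∷ l) n) (varMon v)
    ≡⟨ coeff-factorProduct-∷ i l v ⟩
  coeff (factor v n) (varMon v) + coeff (factorProduct l n) (varMon v)
    ≡⟨ cong₂ _+_ (trans (powSeries-tᵈ (toℕ v) (var v) (varMon v)) (coeff-var-varMon v))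
                 (coeff-factorProduct-∉ v (All¬⇒¬Any i∉l)) ⟩
  1ℚ + 0ℚ ∎
  where open ≡-Reasoning
        n = suc (toℕ v)
coeff-factorProduct-∈ v {i ∷ l} (i∉l ∷ unique) (there v∈l) = begin
  coeff (factorProduct (i ∷ l) n) (varMon v)
    ≡⟨ coeff-factorProduct-∷ i l v ⟩
  coeff (factor i n) (varMon v) + coeff (factorProduct l n) (varMon v)
    ≡⟨ cong₂ _+_ (coeff-powSeries-varMon (suc (toℕ i)) {var i} v (coeff-var-varMon-≢ i≢v) n)
                 (coeff-factorProduct-∈ v unique v∈l) ⟩
  0ℚ + 1ℚ ∎
  where open ≡-Reasoning
        n = suc (toℕ v)
        i≢v : i ≢ v
        i≢v refl = All¬⇒¬Any i∉l v∈l

coeff-A-varMon : ∀ q g (v : Fin g) → coeff (A q g (suc (toℕ v))) (varMon v) ≡ 1ℚ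
coeff-A-varMon q g v = begin
  coeff ((prefactor q *S P) n) e
    ≡⟨ coeff-*S-varMon (prefactor-weightGraded {g} q) (factorProduct-weightGraded (allFin g)) v ⟩
  coeff (prefactor {g} q 0) 0ᴹ * coeff (P n) e + coeff (prefactor q n) e * coeff (P 0) 0ᴹ
    ≡⟨ cong₂ (λ a b → a * coeff (P n) e + b * coeff (P 0) 0ᴹ)
             (coeff-constP-0ᴹ {g} 1ℚ)
             (coeff-weight> (prefactor q n) {m = e} (prefactor-weight≤0 q n) (<-weight-varMon v (s≤s z≤n))) ⟩
  1ℚ * coeff (P n) e + 0ℚ * coeff (P 0) 0ᴹ
    ≡⟨ cong₂ (λ a b → 1ℚ * a + 0ℚ * b)
             (coeff-factorProduct-∈ v (allFin⁺ g) (∈-allFin v)) (coeff-factorProduct-0 (allFin g)) ⟩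
  1ℚ * 1ℚ + 0ℚ * 1ℚ ∎
  where open ≡-Reasoning
        n = suc (toℕ v)
        e = varMon v
        P = factorProduct (allFin g)

-- The triangular system

coeff-triRHS-top : ∀ q g (H : ℕ → Poly g) n (m : Mon g) → (∀ k → k < n → coeff (H k) m ≡ 0ℚ) →
                   coeff (triRHS q g H n) m ≡ coeff (H n) m
coeff-triRHS-top q g H n m lower≡0 = begin
  coeff (triRHS q g H n) m
    ≡⟨ coeff-ΣP n (λ k → summand k (n ∸ k)) m ⟩
  Σℚ n (λ k → coeff (summand k (n ∸ k)) m)
    ≡⟨ Σℚ-single n _ ℕP.≤-refl lower ⟩
  coeff (summand n (n ∸ n)) m
    ≡⟨ cong (λ t → coeff (summand n t) m) (ℕP.n∸n≡0 n) ⟩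
  coeff (H n *P constP 1ℚ) m
    ≡⟨ coeff-*P-constP (H n) 1ℚ m ⟩
  coeff (H n) m * 1ℚ
    ≡⟨ ℚP.*-identityʳ (coeff (H n) m) ⟩
  coeff (H n) m ∎
  where
    open ≡-Reasoning
    scale : ℕ → ℕ → ℚ
    scale k t = ℕtoℚ (((g ∸ k) C (t ℕ./ 2)) ℕ.* (q ℕ.^ (t ℕ./ 2)))
    summand : ℕ → ℕ → Poly g
    summand k t = if does (t ℕ.% 2 ℕ.≟ 0) then H k *P constP (scale k t) else zeroP
    lower : ∀ k → k ≤ n → k ≢ n → coeff (summand k (n ∸ k)) m ≡ 0ℚ
    lower k k≤n k≢n = coeff-if-≡0 ((n ∸ k) ℕ.% 2 ℕ.≟ 0) (begin
      coeff (H k *P constP c) m ≡⟨ coeff-*P-constP (H k) c m ⟩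
      coeff (H k) m * c         ≡⟨ cong (_* c) (lower≡0 k (ℕP.≤∧≢⇒< k≤n k≢n)) ⟩
      0ℚ * c                    ≡⟨ ℚP.*-zeroˡ c ⟩
      0ℚ                        ∎)
      where c = scale k (n ∸ k)

module _ (q g : ℕ) (H : ℕ → Poly g) (hyp : ∀ n → n ≤ g → A q g n ≈P triRHS q g H n) where

  coeff-H≡coeff-A : ∀ {n} → n ≤ g → (m : Mon g) → (∀ k → k < n → coeff (H k) m ≡ 0ℚ) →
                    coeff (H n) m ≡ coeff (A q g n) m
  coeff-H≡coeff-A {n} n≤g m lower≡0 = trans (sym (coeff-triRHS-top q g H n m lower≡0)) (sym (hyp n n≤g m))

  coeff-H-heavy : ∀ n → n ≤ g → (m : Mon g) → n < weight m → coeff (H n) m ≡ 0ℚ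
  coeff-H-heavy = <-rec _ λ n rec n≤g m n<m → begin
    coeff (H n) m
      ≡⟨ coeff-H≡coeff-A n≤g m (λ k k<n →
           rec k<n (ℕP.≤-trans (ℕP.<⇒≤ k<n) n≤g) m (ℕP.<-trans k<n n<m)) ⟩
    coeff (A q g n) m
      ≡⟨ coeff-weight> (A q g n) (A-weight≤ q g n) n<m ⟩
    0ℚ ∎
    where open ≡-Reasoning

  coeff-H-varMon : (v : Fin g) → coeff (H (suc (toℕ v))) (varMon v) ≡ 1ℚ
  coeff-H-varMon v = trans
    (coeff-H≡coeff-A (FinP.toℕ<n v) (varMon v) (λ k k<n →
       coeff-H-heavy k (ℕP.≤-trans (ℕP.<⇒≤ k<n) (FinP.toℕ<n v)) (varMon v) (<-weight-varMon v k<n)))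
    (coeff-A-varMon q g v)

weight≤-lookup : (m : Mon g) (i : Fin g) → weight m ≤ suc (toℕ i) →
                 ((j : Fin g) → toℕ i < toℕ j → lookup m j ≡ 0) × lookup m i ≤ 1
weight≤-lookup {g} m i m≤i = later≡0 , ℕP.*-cancelˡ-≤ (suc (toℕ i)) (ℕP.≤-trans (lookup-weightFrom 0 m i)
                                     (ℕP.≤-trans m≤i (ℕP.≤-reflexive (sym (ℕP.*-identityʳ _)))))
  where
    later≡0 : (j : Fin g) → toℕ i < toℕ j → lookup m j ≡ 0
    later≡0 j i<j = ℕP.n<1⇒n≡0 (ℕP.*-cancelˡ-< (suc (toℕ j)) _ 1
      (ℕP.≤-<-trans (lookup-weightFrom 0 m j)
        (ℕP.≤-<-trans m≤i (subst (suc (toℕ i) <_) (sym (ℕP.*-identityʳ _)) (s≤s i<j)))))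

proposition2p4 : (q g : ℕ) → IsPrimePower q → 1 ≤ g →
    (H : ℕ → Poly g) →
    (∀ n → n ≤ g → A q g n ≈P triRHS q g H n) →
    (i : Fin g) →
      ((m : Mon g) → coeff (H (suc (toℕ i))) m ≢ 0ℚ →
          ((j : Fin g) → toℕ i < toℕ j → lookup m j ≡ 0) × lookup m i ≤ 1)
      × (∃[ m ] (coeff (H (suc (toℕ i))) m ≢ 0ℚ × lookup m i ≡ 1))
proposition2p4 q g _ _ H hyp i =
  (λ m Hm≢0 → weight≤-lookup m i (ℕP.≮⇒≥ (Hm≢0 ∘ coeff-H-heavy q g H hyp n (FinP.toℕ<n i) m))) ,
  (varMon i , ℚP.1≢0 ∘ trans (sym (coeff-H-varMon q g H hyp i)) , VecP.lookup∘update i (replicate g 0) 1)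
  where n = suc (toℕ i)
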